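{- Let $\gamma=((i_1\,j_1),\ldots,(i_k\,j_k))\in\Sigma_n(k)$ and $l,m\in\{1,\ldots,k\}$ with $l<m$. 1. If $i_l=i_m$, then $j_l>j_m$. 2. If $j_l=j_m$, then $i_l>i_m$.
   Context: Permutations are multiplied with the right factor applied first. $\mathsf T_n$ is the set of transpositions of $\{1,\ldots,n\}$; a transposition is written $(i\,j)$ with $i<j$. For $\sigma\in\mathfrak S_n$, $|\sigma|=n-(\text{number of cycles of }\sigma\text{, fixed points included})$, and $\sigma_1\preccurlyeq\sigma_2$ iff $|\sigma_2|=|\sigma_1|+|\sigma_1^{ -1}\sigma_2|$. $\Sigma_n(k)=\{(\tau_1,\ldots,\tau_k)\in(\mathsf T_n)^k : |\tau_1\cdots\tau_k|=k,\ \tau_1\cdots\tau_k\preccurlyeq(1\,2\,\cdots\,n)\}$. -}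

module Defs where

open import Data.Nat using (ℕ; zero; suc; _∸_; _+_)
open import Data.Fin using (Fin; zero; suc; toℕ; fromℕ; inject₁; _<_; _≤_; _≤?_)
open import Data.Fin.Properties using (all?)
open import Data.Fin.Permutation using (Permutation′; permutation; _⟨$⟩ʳ_; flip; _∘ₚ_; transpose; id)
open import Data.List using (List; length; filter; allFin)
open import Data.Product using (Σ; Σ-syntax; _×_; _,_; proj₁; proj₂)
open import Relation.Binary.PropositionalEquality using (_≡_; refl; cong)
open import Relation.Nullary using (Dec)

-- Product of permutations, right factor applied first: (σ · τ)(x) = σ (τ x).
_·_ : ∀ {n} → Permutation′ n → Permutation′ n → Permutation′ n
σ · τ = τ ∘ₚ σ

_⁻¹ : ∀ {n} → Permutation′ n → Permutation′ n
σ ⁻¹ = flip σ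

iter : ∀ {n} → ℕ → Permutation′ n → Fin n → Fin n
iter zero    σ x = x
iter (suc t) σ x = σ ⟨$⟩ʳ (iter t σ x)

-- Each cycle of σ (fixed points included) is counted once, via its least
-- element: x is the least element of its cycle iff x ≤ σ^t(x) for t = 1..n
-- (every cycle has length ≤ n).
IsCycleMin : ∀ {n} → Permutation′ n → Fin n → Set
IsCycleMin {n} σ x = ∀ (t : Fin n) → x ≤ iter (suc (toℕ t)) σ x

isCycleMin? : ∀ {n} (σ : Permutation′ n) (x : Fin n) → Dec (IsCycleMin σ x)
isCycleMin? σ x = all? (λ t → x ≤? iter (suc (toℕ t)) σ x)

cycles : ∀ {n} → Permutation′ n → ℕ
cycles {n} σ = length (filter (isCycleMin? σ) (allFin n))

∣_∣ : ∀ {n} → Permutation′ n → ℕ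
∣_∣ {n} σ = n ∸ cycles σ

_≼_ : ∀ {n} → Permutation′ n → Permutation′ n → Set
σ₁ ≼ σ₂ = ∣ σ₂ ∣ ≡ ∣ σ₁ ∣ + ∣ (σ₁ ⁻¹) · σ₂ ∣

-- The long cycle (1 2 ⋯ n), i.e. x ↦ x+1 (mod n), on Fin (suc n) with 0-based labels.
up : ∀ m → Fin (suc m) → Fin (suc m)
up zero    zero    = zero
up (suc m) zero    = suc zero
up (suc m) (suc i) with up m i
... | zero  = zero
... | suc k = suc (suc k)

down : ∀ m → Fin (suc m) → Fin (suc m)
down m zero    = fromℕ m
down m (suc k) = inject₁ k

up-fromℕ : ∀ m → up m (fromℕ m) ≡ zero
up-fromℕ zero = refl
up-fromℕ (suc m) rewrite up-fromℕ m = refl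

up-inject₁ : ∀ m (k : Fin m) → up m (inject₁ k) ≡ suc k
up-inject₁ (suc m) zero = refl
up-inject₁ (suc m) (suc k) rewrite up-inject₁ m k = refl

up-down : ∀ m (x : Fin (suc m)) → up m (down m x) ≡ x
up-down m zero    = up-fromℕ m
up-down m (suc k) = up-inject₁ m k

down-up : ∀ m (x : Fin (suc m)) → down m (up m x) ≡ x
down-up zero    zero    = refl
down-up (suc m) zero    = refl
down-up (suc m) (suc i) with up m i | down-up m i
... | zero  | e = cong suc e
... | suc k | e = cong suc e

longCycle : ∀ n → Permutation′ n
longCycle zero    = id
longCycle (suc m) = permutation (up m) (down m) (up-down m) (down-up m)

Transposition : ℕ → Set
Transposition n = Σ[ i ∈ Fin n ] Σ[ j ∈ Fin n ] i < j

fst : ∀ {n} → Transposition n → Fin n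
fst (i , _ , _) = i

snd : ∀ {n} → Transposition n → Fin n
snd (_ , j , _) = j

toPerm : ∀ {n} → Transposition n → Permutation′ n
toPerm (i , j , _) = transpose i j

prod : ∀ {n k} → (Fin k → Transposition n) → Permutation′ n
prod {k = zero}  γ = id
prod {k = suc k} γ = toPerm (γ zero) · prod (λ l → γ (suc l))

InΣ : ∀ n k → (Fin k → Transposition n) → Set
InΣ n k γ = (∣ prod γ ∣ ≡ k) × (prod γ ≼ longCycle n)

-- Put σ = τ₁⋯τₖ and μ = σ⁻¹c, so that c = σμ.  The hypothesis says
-- cycles μ = cycles c + k.  Moving τ_l and then τ_m to the front of the word (conjugating
-- the letters they pass) and cancelling them shows that Z = τ_m τ_l c equals a word of
-- k − 2 transpositions applied after μ.  Since one transposition merges at most two cycles,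
-- cycles μ ≤ cycles Z + (k − 2); hence cycles Z < cycles c.  But if the two letters share
-- an endpoint and are not decreasing, then either τ_l = τ_m and Z = c, or τ_m τ_l is a
-- 3-cycle p ↦ q ↦ r ↦ p with p < q < r, and then Z is again a single cycle.

module Submission where

open import Defs
open import Data.Empty using (⊥; ⊥-elim)
open import Data.Fin using (Fin; zero; suc; toℕ; fromℕ; fromℕ<; inject₁; lower₁; _<_; _≤_; _≟_; _<?_)
import Data.Fin.Properties as FP
open import Data.Fin.Permutation using (Permutation′; _⟨$⟩ʳ_; _⟨$⟩ˡ_; transpose; _∘ₚ_; inverseʳ; inverseˡ; id)
import Data.Fin.Permutation.Components as PC
open import Data.List using ([]; _∷_; length; filter; allFin)
open import Data.List.Properties using (filter-≐; filter-none; filter-some)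
open import Data.List.Relation.Unary.All as All using (All)
open import Data.List.Relation.Unary.Any using (here)
import Data.List.Relation.Unary.AllPairs as AllPairs
open import Data.List.Relation.Unary.Unique.Propositional using (Unique)
open import Data.List.Relation.Unary.Unique.Propositional.Properties using (allFin⁺)
open import Data.Nat as ℕ using (ℕ; zero; suc; _+_; _∸_; _*_; z≤n; s≤s)
import Data.Nat.Properties as ℕP
open import Data.Nat.DivMod using (_%_; _/_; m≡m%n+[m/n]*n; m%n<n)
open import Data.Product using (Σ; _×_; _,_; proj₁; proj₂)
open import Data.Sum using (_⊎_; inj₁; inj₂)
import Data.Sum as Sum
open import Function using (_∘_)
open import Relation.Binary.PropositionalEquality
open import Relation.Nullary using (¬_; Dec; yes; no)
open import Relation.Nullary.Decidable using (decidable-stable)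
open import Relation.Unary using (Decidable; _⊆_)
open import Relation.Unary.Properties using (_∩?_; ∁?)

>⇒≢ : ∀ {n} {u v : Fin n} → v < u → u ≢ v
>⇒≢ v<u u≡v = FP.<⇒≢ v<u (sym u≡v)

swap : ∀ {n} → Fin n → Fin n → Fin n → Fin n
swap = PC.transpose

swap-left : ∀ {n} (a b : Fin n) → swap a b a ≡ b
swap-left a b with a ≟ a
... | yes _   = refl
... | no a≢a = ⊥-elim (a≢a refl)

swap-right : ∀ {n} (a b : Fin n) → swap a b b ≡ a
swap-right a b with b ≟ a
... | yes b≡a = b≡a
... | no _ with b ≟ b
...   | yes _   = refl
...   | no b≢b = ⊥-elim (b≢b refl)

swap-fixes : ∀ {n} (a b w : Fin n) → w ≢ a → w ≢ b → swap a b w ≡ w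
swap-fixes a b w w≢a w≢b with w ≟ a
... | yes w≡a = ⊥-elim (w≢a w≡a)
... | no _ with w ≟ b
...   | yes w≡b = ⊥-elim (w≢b w≡b)
...   | no _    = refl

swap-involutive : ∀ {n} (a b w : Fin n) → swap a b (swap a b w) ≡ w
swap-involutive {n} a b w = by-cases (w ≟ a) (w ≟ b)
  where
  by-cases : Dec (w ≡ a) → Dec (w ≡ b) → swap a b (swap a b w) ≡ w
  by-cases (yes w≡a) _ = begin
    swap a b (swap a b w) ≡⟨ cong (swap a b ∘ swap a b) w≡a ⟩
    swap a b (swap a b a) ≡⟨ cong (swap a b) (swap-left a b) ⟩
    swap a b b            ≡⟨ swap-right a b ⟩
    a                     ≡⟨ sym w≡a ⟩
    w                     ∎
    where open ≡-Reasoning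
  by-cases (no _) (yes w≡b) = begin
    swap a b (swap a b w) ≡⟨ cong (swap a b ∘ swap a b) w≡b ⟩
    swap a b (swap a b b) ≡⟨ cong (swap a b) (swap-right a b) ⟩
    swap a b a            ≡⟨ swap-left a b ⟩
    b                     ≡⟨ sym w≡b ⟩
    w                     ∎
    where open ≡-Reasoning
  by-cases (no w≢a) (no w≢b) =
    trans (cong (swap a b) (swap-fixes a b w w≢a w≢b)) (swap-fixes a b w w≢a w≢b)

swap-injective : ∀ {n} (a b : Fin n) {u v} → swap a b u ≡ swap a b v → u ≡ v
swap-injective a b {u} {v} e =
  trans (sym (swap-involutive a b u)) (trans (cong (swap a b) e) (swap-involutive a b v))

-- Conjugation: (a b)(c d) = ((a b)c (a b)d)(a b).  This lets a letter move to the front of a word.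
swap-conjugate : ∀ {n} (a b c d w : Fin n) →
                 swap a b (swap c d w) ≡ swap (swap a b c) (swap a b d) (swap a b w)
swap-conjugate a b c d w = by-cases (w ≟ c) (w ≟ d)
  where
  s = swap a b
  by-cases : Dec (w ≡ c) → Dec (w ≡ d) → s (swap c d w) ≡ swap (s c) (s d) (s w)
  by-cases (yes w≡c) _ = begin
    s (swap c d w)            ≡⟨ cong (s ∘ swap c d) w≡c ⟩
    s (swap c d c)            ≡⟨ cong s (swap-left c d) ⟩
    s d                       ≡⟨ sym (swap-left (s c) (s d)) ⟩
    swap (s c) (s d) (s c)    ≡⟨ cong (swap (s c) (s d) ∘ s) (sym w≡c) ⟩
    swap (s c) (s d) (s w)    ∎
    where open ≡-Reasoning
  by-cases (no _) (yes w≡d) = begin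
    s (swap c d w)            ≡⟨ cong (s ∘ swap c d) w≡d ⟩
    s (swap c d d)            ≡⟨ cong s (swap-right c d) ⟩
    s c                       ≡⟨ sym (swap-right (s c) (s d)) ⟩
    swap (s c) (s d) (s d)    ≡⟨ cong (swap (s c) (s d) ∘ s) (sym w≡d) ⟩
    swap (s c) (s d) (s w)    ∎
    where open ≡-Reasoning
  by-cases (no w≢c) (no w≢d) = trans (cong s (swap-fixes c d w w≢c w≢d))
    (sym (swap-fixes _ _ _ (w≢c ∘ swap-injective a b) (w≢d ∘ swap-injective a b)))

record Is3Cycle {n} (ρ : Fin n → Fin n) (p q r : Fin n) : Set where
  field
    at-p      : ρ p ≡ q
    at-q      : ρ q ≡ r
    at-r      : ρ r ≡ p
    elsewhere : ∀ w → w ≢ p → w ≢ q → w ≢ r → ρ w ≡ w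

shared-first-3cycle : ∀ {n} {i a b : Fin n} → i < a → a < b →
                      Is3Cycle (λ w → swap i b (swap i a w)) i a b
shared-first-3cycle {i = i} {a} {b} i<a a<b = record
  { at-p = trans (cong (swap i b) (swap-left i a)) (swap-fixes i b a (>⇒≢ i<a) (FP.<⇒≢ a<b))
  ; at-q = trans (cong (swap i b) (swap-right i a)) (swap-left i b)
  ; at-r = trans (cong (swap i b) (swap-fixes i a b (>⇒≢ (ℕP.<-trans i<a a<b)) (>⇒≢ a<b)))
                 (swap-right i b)
  ; elsewhere = λ w w≢i w≢a w≢b →
      trans (cong (swap i b) (swap-fixes i a w w≢i w≢a)) (swap-fixes i b w w≢i w≢b)
  }

shared-second-3cycle : ∀ {n} {a b j : Fin n} → a < b → b < j →
                       Is3Cycle (λ w → swap b j (swap a j w)) a b j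
shared-second-3cycle {a = a} {b} {j} a<b b<j = record
  { at-p = trans (cong (swap b j) (swap-left a j)) (swap-right b j)
  ; at-q = trans (cong (swap b j) (swap-fixes a j b (>⇒≢ a<b) (FP.<⇒≢ b<j))) (swap-left b j)
  ; at-r = trans (cong (swap b j) (swap-right a j)) (swap-fixes b j a (FP.<⇒≢ a<b) (FP.<⇒≢ (ℕP.<-trans a<b b<j)))
  ; elsewhere = λ w w≢a w≢b w≢j →
      trans (cong (swap b j) (swap-fixes a j w w≢a w≢j)) (swap-fixes b j w w≢b w≢j)
  }

module Counting {A : Set} where

  count-split : ∀ {P Q : A → Set} (P? : Decidable P) (Q? : Decidable Q) xs →
                length (filter P? xs) ℕ.≤ length (filter Q? xs) + length (filter (P? ∩? ∁? Q?) xs)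
  count-split P? Q? [] = z≤n
  count-split P? Q? (x ∷ xs) with P? x | Q? x
  ... | yes _ | yes _ = s≤s (count-split P? Q? xs)
  ... | yes _ | no _  = ℕP.≤-trans (s≤s (count-split P? Q? xs)) (ℕP.≤-reflexive (sym (ℕP.+-suc _ _)))
  ... | no _  | yes _ = ℕP.m≤n⇒m≤1+n (count-split P? Q? xs)
  ... | no _  | no _  = count-split P? Q? xs

  count-≤1 : ∀ {B : A → Set} (B? : Decidable B) → (∀ x y → B x → B y → x ≡ y) →
             ∀ xs → Unique xs → length (filter B? xs) ℕ.≤ 1
  count-≤1 B? unique [] _ = z≤n
  count-≤1 B? unique (x ∷ xs) (x∉xs AllPairs.∷ distinct) with B? x
  ... | no _   = count-≤1 B? unique xs distinct
  ... | yes bx = s≤s (ℕP.≤-reflexive (cong length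
                   (filter-none B? (All.map (λ x≢y by → x≢y (unique x _ bx by)) x∉xs))))

open Counting

module Orbits {n : ℕ} (g : Permutation′ n) where

  iter-+ : ∀ a b x → iter (a + b) g x ≡ iter a g (iter b g x)
  iter-+ zero    b x = refl
  iter-+ (suc a) b x = cong (g ⟨$⟩ʳ_) (iter-+ a b x)

  iter-injective : ∀ s {x y} → iter s g x ≡ iter s g y → x ≡ y
  iter-injective zero    e = e
  iter-injective (suc s) e =
    iter-injective s (trans (sym (inverseˡ g)) (trans (cong (g ⟨$⟩ˡ_) e) (inverseˡ g)))

  period : ∀ x → Σ ℕ λ p → suc p ℕ.≤ n × iter (suc p) g x ≡ x
  period x with FP.pigeonhole (ℕP.n<1+n n) (λ i → iter (toℕ i) g x)
  ... | i , j , i<j , same = toℕ j ∸ suc (toℕ i) , bound , iter-injective (toℕ i) returns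
    where
    p = toℕ j ∸ suc (toℕ i)
    i+1+p≡j : suc (toℕ i) + p ≡ toℕ j
    i+1+p≡j = ℕP.m+[n∸m]≡n i<j
    bound : suc p ℕ.≤ n
    bound = ℕP.≤-trans (s≤s (ℕP.m≤n+m p (toℕ i)))
                       (subst (ℕ._≤ n) (sym i+1+p≡j) (ℕ.s≤s⁻¹ (FP.toℕ<n j)))
    returns : iter (toℕ i) g (iter (suc p) g x) ≡ iter (toℕ i) g x
    returns = begin
      iter (toℕ i) g (iter (suc p) g x) ≡⟨ sym (iter-+ (toℕ i) (suc p) x) ⟩
      iter (toℕ i + suc p) g x          ≡⟨ cong (λ t → iter t g x) (trans (ℕP.+-suc (toℕ i) p) i+1+p≡j) ⟩
      iter (toℕ j) g x                  ≡⟨ sym same ⟩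
      iter (toℕ i) g x                  ∎
      where open ≡-Reasoning

  iter-multiple : ∀ {x} p → iter (suc p) g x ≡ x → ∀ q → iter (q * suc p) g x ≡ x
  iter-multiple p ret zero    = refl
  iter-multiple {x} p ret (suc q) =
    trans (iter-+ (suc p) (q * suc p) x) (trans (cong (iter (suc p) g) (iter-multiple p ret q)) ret)

  iter-mod : ∀ {x} p → iter (suc p) g x ≡ x → ∀ s → iter s g x ≡ iter (s % suc p) g x
  iter-mod {x} p ret s = begin
    iter s g x                                          ≡⟨ cong (λ t → iter t g x) (m≡m%n+[m/n]*n s (suc p)) ⟩
    iter (s % suc p + s / suc p * suc p) g x            ≡⟨ iter-+ (s % suc p) _ x ⟩
    iter (s % suc p) g (iter (s / suc p * suc p) g x)   ≡⟨ cong (iter (s % suc p) g) (iter-multiple p ret (s / suc p)) ⟩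
    iter (s % suc p) g x                                ∎
    where open ≡-Reasoning

  _⇝_ : Fin n → Fin n → Set
  x ⇝ z = Σ ℕ λ s → iter s g x ≡ z

  ⇝-refl : ∀ {x} → x ⇝ x
  ⇝-refl = 0 , refl

  ⇝-step : ∀ {x z} → x ⇝ z → x ⇝ (g ⟨$⟩ʳ z)
  ⇝-step (s , e) = suc s , cong (g ⟨$⟩ʳ_) e

  ⇝-trans : ∀ {x y z} → x ⇝ y → y ⇝ z → x ⇝ z
  ⇝-trans {x} (s , refl) (t , e) = t + s , trans (iter-+ t s x) e

  -- Orbits are symmetric: going once more around the cycle leads back.
  ⇝-sym : ∀ {x z} → x ⇝ z → z ⇝ x
  ⇝-sym {x} (s , refl) with period x
  ... | p , _ , ret = s * p , (begin
    iter (s * p) g (iter s g x) ≡⟨ sym (iter-+ (s * p) s x) ⟩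
    iter (s * p + s) g x        ≡⟨ cong (λ t → iter t g x) (trans (ℕP.+-comm (s * p) s) (sym (ℕP.*-suc s p))) ⟩
    iter (s * suc p) g x        ≡⟨ iter-multiple p ret s ⟩
    x                           ∎)
    where open ≡-Reasoning

  min-≤-short : ∀ {x} → IsCycleMin g x → ∀ s → s ℕ.≤ n → x ≤ iter s g x
  min-≤-short min zero    _   = FP.≤-refl
  min-≤-short {x} min (suc s) s<n =
    subst (λ t → x ≤ iter (suc t) g x) (FP.toℕ-fromℕ< s<n) (min (fromℕ< s<n))

  min-≤-orbit : ∀ {x z} → IsCycleMin g x → x ⇝ z → x ≤ z
  min-≤-orbit {x} min (s , refl) with period x
  ... | p , p<n , ret = subst (x ≤_) (sym (iter-mod p ret s))
    (min-≤-short min (s % suc p) (ℕP.≤-trans (ℕP.<⇒≤ (m%n<n s (suc p))) p<n))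

  ¬min⇒smaller : ∀ {x} → ¬ IsCycleMin g x → Σ ℕ λ s → iter s g x < x
  ¬min⇒smaller {x} ¬min with FP.¬∀⟶∃¬ n _ (λ t → x FP.≤? iter (suc (toℕ t)) g x) ¬min
  ... | t , x≰ = suc (toℕ t) , ℕP.≰⇒> x≰

  min-unique : ∀ {x y} → IsCycleMin g x → IsCycleMin g y → x ⇝ y → x ≡ y
  min-unique mx my x⇝y = FP.≤-antisym (min-≤-orbit mx x⇝y) (min-≤-orbit my (⇝-sym x⇝y))

  one-orbit : (c : Fin n) → (∀ x → x ⇝ c) → cycles g ℕ.≤ 1
  one-orbit c to-c = count-≤1 (isCycleMin? g)
    (λ x y mx my → min-unique mx my (⇝-trans (to-c x) (⇝-sym (to-c y)))) (allFin n) (allFin⁺ n)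

cycles-≗ : ∀ {n} (g h : Permutation′ n) → (∀ x → g ⟨$⟩ʳ x ≡ h ⟨$⟩ʳ x) → cycles g ≡ cycles h
cycles-≗ {n} g h g≗h =
  cong length (filter-≐ (isCycleMin? g) (isCycleMin? h) (transfer g h g≗h , transfer h g (sym ∘ g≗h)) (allFin n))
  where
  iter-≗ : ∀ (g h : Permutation′ n) → (∀ x → g ⟨$⟩ʳ x ≡ h ⟨$⟩ʳ x) → ∀ s x → iter s g x ≡ iter s h x
  iter-≗ g h g≗h zero    x = refl
  iter-≗ g h g≗h (suc s) x = trans (g≗h _) (cong (h ⟨$⟩ʳ_) (iter-≗ g h g≗h s x))
  transfer : ∀ (g h : Permutation′ n) → (∀ x → g ⟨$⟩ʳ x ≡ h ⟨$⟩ʳ x) → IsCycleMin g ⊆ IsCycleMin h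
  transfer g h g≗h {x} min t = subst (x ≤_) (iter-≗ g h g≗h (suc (toℕ t)) x) (min t)

-- The point 0 is always a cycle minimum, so a permutation of a nonempty set has a cycle.
cycles-positive : ∀ {m} (g : Permutation′ (suc m)) → 1 ℕ.≤ cycles g
cycles-positive g = filter-some (isCycleMin? g) (here (λ _ → z≤n))

-- One transposition merges at most two cycles:  h = (a b) ∘ g  ⇒  cycles g ≤ cycles h + 1.
-- Only g-minima whose orbit meets {a, b} can stop being h-minima, and at most one does.
module TranspositionStep {n : ℕ} (g h : Permutation′ n) (a b : Fin n)
                         (h≗ : ∀ x → h ⟨$⟩ʳ x ≡ swap a b (g ⟨$⟩ʳ x)) where
  open Orbits g
  module H = Orbits h

  agree-or-hit : ∀ x s → iter s h x ≡ iter s g x ⊎ (x ⇝ a ⊎ x ⇝ b)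
  agree-or-hit x zero = inj₁ refl
  agree-or-hit x (suc s) with agree-or-hit x s
  ... | inj₂ hit = inj₂ hit
  ... | inj₁ same with g ⟨$⟩ʳ iter s g x ≟ a | g ⟨$⟩ʳ iter s g x ≟ b
  ...   | yes hits-a | _          = inj₂ (inj₁ (suc s , hits-a))
  ...   | no _       | yes hits-b = inj₂ (inj₂ (suc s , hits-b))
  ...   | no ≢a      | no ≢b      =
          inj₁ (trans (h≗ _) (trans (cong (λ z → swap a b (g ⟨$⟩ʳ z)) same) (swap-fixes a b _ ≢a ≢b)))

  lost-min-hits : ∀ {x} → IsCycleMin g x → ¬ IsCycleMin h x → x ⇝ a ⊎ x ⇝ b
  lost-min-hits {x} mx ¬hx with H.¬min⇒smaller ¬hx
  ... | s , below with agree-or-hit x s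
  ...   | inj₂ hit  = hit
  ...   | inj₁ same = ⊥-elim (ℕP.<⇒≱ below (subst (x ≤_) (sym same) (min-≤-orbit mx (s , refl))))

  InEither : Fin n → Fin n → Fin n → Set
  InEither x y z = x ⇝ z ⊎ y ⇝ z

  h-closed : ∀ {x y} → InEither x y a → InEither x y b → ∀ s {z} → InEither x y z → InEither x y (iter s h z)
  h-closed ina inb zero    inz = inz
  h-closed {x} {y} ina inb (suc s) {z} inz with h-closed ina inb s inz
  ... | ih with g ⟨$⟩ʳ iter s h z ≟ a | g ⟨$⟩ʳ iter s h z ≟ b
  ...   | yes ≡a | _     = subst (InEither x y) (sym (trans (h≗ _) (trans (cong (swap a b) ≡a) (swap-left a b)))) inb
  ...   | no _   | yes ≡b = subst (InEither x y) (sym (trans (h≗ _) (trans (cong (swap a b) ≡b) (swap-right a b)))) ina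
  ...   | no ≢a  | no ≢b  = subst (InEither x y) (sym (trans (h≗ _) (swap-fixes a b _ ≢a ≢b))) (Sum.map ⇝-step ⇝-step ih)

  lost-above : ∀ {x y} → IsCycleMin g x → ¬ IsCycleMin h x → IsCycleMin g y →
               InEither x y a → InEither x y b → y < x
  lost-above mx ¬hx my ina inb with H.¬min⇒smaller ¬hx
  ... | s , below with h-closed ina inb s (inj₁ ⇝-refl)
  ...   | inj₁ x⇝ = ⊥-elim (ℕP.<⇒≱ below (min-≤-orbit mx x⇝))
  ...   | inj₂ y⇝ = ℕP.≤-<-trans (min-≤-orbit my y⇝) below

  at-most-one-lost : ∀ {x y} → IsCycleMin g x → ¬ IsCycleMin h x →
                     IsCycleMin g y → ¬ IsCycleMin h y → x ≡ y
  at-most-one-lost mx ¬hx my ¬hy with lost-min-hits mx ¬hx | lost-min-hits my ¬hy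
  ... | inj₁ x⇝a | inj₁ y⇝a = min-unique mx my (⇝-trans x⇝a (⇝-sym y⇝a))
  ... | inj₂ x⇝b | inj₂ y⇝b = min-unique mx my (⇝-trans x⇝b (⇝-sym y⇝b))
  ... | inj₁ x⇝a | inj₂ y⇝b = ⊥-elim (ℕP.<-asym (lost-above mx ¬hx my (inj₁ x⇝a) (inj₂ y⇝b))
                                                 (lost-above my ¬hy mx (inj₂ x⇝a) (inj₁ y⇝b)))
  ... | inj₂ x⇝b | inj₁ y⇝a = ⊥-elim (ℕP.<-asym (lost-above mx ¬hx my (inj₂ y⇝a) (inj₁ x⇝b))
                                                 (lost-above my ¬hy mx (inj₁ y⇝a) (inj₂ x⇝b)))

    -- Counting: #g-minima ≤ #h-minima + #(g-minima that are not h-minima) ≤ cycles h + 1.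
  cycles-step : cycles g ℕ.≤ cycles h + 1
  cycles-step = ℕP.≤-trans (count-split (isCycleMin? g) (isCycleMin? h) (allFin n))
    (ℕP.+-monoʳ-≤ (cycles h) (count-≤1 (isCycleMin? g ∩? ∁? (isCycleMin? h))
      (λ x y (mx , ¬hx) (my , ¬hy) → at-most-one-lost mx ¬hx my ¬hy) (allFin n) (allFin⁺ n)))

-- A letter is an unordered pair of points (conjugation does not preserve the order i < j).
Pair : ℕ → Set
Pair n = Fin n × Fin n

swapP : ∀ {n} → Pair n → Fin n → Fin n
swapP (a , b) = swap a b

Word : ℕ → ℕ → Set
Word n k = Fin k → Pair n

apply : ∀ {n k} → Word n k → Fin n → Fin n
apply {k = zero}  δ x = x
apply {k = suc k} δ x = swapP (δ zero) (apply (δ ∘ suc) x)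

wordPerm : ∀ {n k} → Word n k → Permutation′ n
wordPerm {k = zero}  δ = id
wordPerm {k = suc k} δ = wordPerm (δ ∘ suc) ∘ₚ transpose (proj₁ (δ zero)) (proj₂ (δ zero))

wordPerm-apply : ∀ {n k} (δ : Word n k) x → wordPerm δ ⟨$⟩ʳ x ≡ apply δ x
wordPerm-apply {k = zero}  δ x = refl
wordPerm-apply {k = suc k} δ x = cong (swapP (δ zero)) (wordPerm-apply (δ ∘ suc) x)

cycles-word : ∀ {n} k (δ : Word n k) (g h : Permutation′ n) →
              (∀ x → h ⟨$⟩ʳ x ≡ apply δ (g ⟨$⟩ʳ x)) → cycles g ℕ.≤ cycles h + k
cycles-word zero δ g h h≗ =
  ℕP.≤-reflexive (trans (cycles-≗ g h (sym ∘ h≗)) (sym (ℕP.+-identityʳ _)))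
cycles-word (suc k) δ g h h≗ = begin
  cycles g          ≤⟨ cycles-word k (δ ∘ suc) g g′ (λ x → wordPerm-apply (δ ∘ suc) (g ⟨$⟩ʳ x)) ⟩
  cycles g′ + k     ≤⟨ ℕP.+-monoˡ-≤ k (TranspositionStep.cycles-step g′ h (proj₁ (δ zero)) (proj₂ (δ zero)) h≗′) ⟩
  cycles h + 1 + k  ≡⟨ ℕP.+-assoc (cycles h) 1 k ⟩
  cycles h + suc k  ∎
  where
  open ℕP.≤-Reasoning
  g′ = g ∘ₚ wordPerm (δ ∘ suc)
  h≗′ : ∀ x → h ⟨$⟩ʳ x ≡ swapP (δ zero) (g′ ⟨$⟩ʳ x)
  h≗′ x = trans (h≗ x) (cong (swapP (δ zero)) (sym (wordPerm-apply (δ ∘ suc) (g ⟨$⟩ʳ x))))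

conj : ∀ {n} → Pair n → Pair n → Pair n
conj t (c , d) = swapP t c , swapP t d

-- Delete letter l after moving it to the front, conjugating the letters it passes.
remove : ∀ {n k} → Word n (suc k) → Fin (suc k) → Word n k
remove δ zero = δ ∘ suc
remove {k = suc k} δ (suc l) zero    = conj (δ (suc l)) (δ zero)
remove {k = suc k} δ (suc l) (suc j) = remove (δ ∘ suc) l j

remove-apply : ∀ {n k} (δ : Word n (suc k)) l y → swapP (δ l) (apply δ y) ≡ apply (remove δ l) y
remove-apply δ zero y = swap-involutive _ _ _
remove-apply {k = suc k} δ (suc l) y =
  trans (swap-conjugate _ _ (proj₁ (δ zero)) (proj₂ (δ zero)) (apply (δ ∘ suc) y))
        (cong (swapP (conj (δ (suc l)) (δ zero))) (remove-apply (δ ∘ suc) l y))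

remove-later : ∀ {n k} (δ : Word n (suc k)) l j → toℕ l ℕ.≤ toℕ j → remove δ l j ≡ δ (suc j)
remove-later δ zero j _ = refl
remove-later {k = suc k} δ (suc l) (suc j) (s≤s l≤j) = remove-later (δ ∘ suc) l j l≤j

pairOf : ∀ {n} → Transposition n → Pair n
pairOf t = fst t , snd t

prod-apply : ∀ {n k} (γ : Fin k → Transposition n) x → prod γ ⟨$⟩ʳ x ≡ apply (pairOf ∘ γ) x
prod-apply {k = zero}  γ x = refl
prod-apply {k = suc k} γ x = cong (swapP (pairOf (γ zero))) (prod-apply (γ ∘ suc) x)

cancel-pair : ∀ {n k} (γ : Fin (suc (suc k)) → Transposition n) l m → l < m → (g h : Permutation′ n) →
              (∀ x → h ⟨$⟩ʳ x ≡ swapP (pairOf (γ m)) (swapP (pairOf (γ l)) (prod γ ⟨$⟩ʳ (g ⟨$⟩ʳ x)))) →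
              cycles g ℕ.≤ cycles h + k
cancel-pair {k = k} γ l (suc j) (s≤s l≤j) g h h≗ = cycles-word k δ₂ g h (λ x → trans (h≗ x) (cancels (g ⟨$⟩ʳ x)))
  where
  δ  = pairOf ∘ γ
  δ₁ = remove δ l
  δ₂ = remove δ₁ j
  cancels : ∀ y → swapP (δ (suc j)) (swapP (δ l) (prod γ ⟨$⟩ʳ y)) ≡ apply δ₂ y
  cancels y = begin
    swapP (δ (suc j)) (swapP (δ l) (prod γ ⟨$⟩ʳ y)) ≡⟨ cong (swapP (δ (suc j)) ∘ swapP (δ l)) (prod-apply γ y) ⟩
    swapP (δ (suc j)) (swapP (δ l) (apply δ y))     ≡⟨ cong (swapP (δ (suc j))) (remove-apply δ l y) ⟩
    swapP (δ (suc j)) (apply δ₁ y)                  ≡⟨ cong (λ t → swapP t (apply δ₁ y)) (sym (remove-later δ l j l≤j)) ⟩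
    swapP (δ₁ j) (apply δ₁ y)                       ≡⟨ remove-apply δ₁ j y ⟩
    apply δ₂ y                                      ∎
    where open ≡-Reasoning

∸-gap : ∀ n a b k → n ∸ a ≡ suc (suc k) + (n ∸ b) → b ℕ.≤ a + k → ⊥
∸-gap n a b k gap b≤a+k = ℕP.<⇒≱ (ℕP.≤-trans (ℕP.n≤1+n _) (ℕP.≤-reflexive (sym gap))) (begin
  n ∸ a            ≤⟨ ℕP.m≤n+m∸n (n ∸ a) k ⟩
  k + (n ∸ a ∸ k)  ≡⟨ cong (k +_) (ℕP.∸-+-assoc n a k) ⟩
  k + (n ∸ (a + k)) ≤⟨ ℕP.+-monoʳ-≤ k (ℕP.∸-monoʳ-≤ n b≤a+k) ⟩
  k + (n ∸ b)      ∎)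
  where open ℕP.≤-Reasoning

no-cycle-preserving-pair : ∀ n k (γ : Fin k → Transposition n) → InΣ n k γ → ∀ l m → l < m →
  (Z : Permutation′ n) → (∀ x → Z ⟨$⟩ʳ x ≡ swapP (pairOf (γ m)) (swapP (pairOf (γ l)) (longCycle n ⟨$⟩ʳ x))) →
  cycles Z ℕ.≤ cycles (longCycle n) → ⊥
no-cycle-preserving-pair n (suc (suc k)) γ (length≡k , below-c) l m@(suc _) l<m Z Z≗ Z≤c =
  ∸-gap n (cycles c) (cycles μ) k (trans below-c (cong (_+ ∣ μ ∣) length≡k)) (begin
    cycles μ     ≤⟨ cancel-pair γ l m l<m μ Z (λ x → trans (Z≗ x) (cong (swapP (pairOf (γ m)) ∘ swapP (pairOf (γ l))) (sym (inverseʳ σ {c ⟨$⟩ʳ x})))) ⟩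
    cycles Z + k ≤⟨ ℕP.+-monoˡ-≤ k Z≤c ⟩
    cycles c + k ∎)
  where
  open ℕP.≤-Reasoning
  σ = prod γ
  c = longCycle n
  μ = (σ ⁻¹) · c

up-suc : ∀ m (y : Fin (suc m)) → toℕ y ℕ.< m → toℕ (up m y) ≡ suc (toℕ y)
up-suc m y y<m = begin
  toℕ (up m y)                   ≡⟨ cong (toℕ ∘ up m) (sym (FP.inject₁-lower₁ y m≢y)) ⟩
  toℕ (up m (inject₁ (lower₁ y m≢y))) ≡⟨ cong toℕ (up-inject₁ m (lower₁ y m≢y)) ⟩
  suc (toℕ (lower₁ y m≢y))       ≡⟨ cong suc (FP.toℕ-lower₁ y m≢y) ⟩
  suc (toℕ y)                    ∎
  where
  open ≡-Reasoning
  m≢y : m ≢ toℕ y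
  m≢y m≡y = ℕP.<-irrefl (sym m≡y) y<m

-- Z = ρ ∘ (x ↦ x + 1): where ρ fixes points, Z simply steps upward.
module ShiftThen {m : ℕ} (ρ : Fin (suc m) → Fin (suc m)) (Z : Permutation′ (suc m))
                 (Z≗ : ∀ y → Z ⟨$⟩ʳ y ≡ ρ (up m y)) where
  open Orbits Z

  walk-by : ∀ d x z → toℕ x + d ≡ toℕ z → (∀ w → x < w → w ≤ z → ρ w ≡ w) → x ⇝ z
  walk-by zero x z x+0≡z _ = 0 , FP.toℕ-injective (trans (sym (ℕP.+-identityʳ _)) x+0≡z)
  walk-by (suc d) x z x+d≡z fixed = ⇝-trans (1 , step) (walk-by d (up m x) z x′+d≡z fixed′)
    where
    x<z : x < z
    x<z = subst (toℕ x ℕ.<_) x+d≡z (ℕP.m<m+n (toℕ x) (s≤s z≤n))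
    up-x : toℕ (up m x) ≡ suc (toℕ x)
    up-x = up-suc m x (ℕP.<-≤-trans x<z (ℕ.s≤s⁻¹ (FP.toℕ<n z)))
    x<x′ : x < up m x
    x<x′ = ℕP.≤-reflexive (sym up-x)
    step : Z ⟨$⟩ʳ x ≡ up m x
    step = trans (Z≗ x) (fixed (up m x) x<x′ (subst (ℕ._≤ toℕ z) (sym up-x) x<z))
    x′+d≡z : toℕ (up m x) + d ≡ toℕ z
    x′+d≡z = trans (cong (_+ d) up-x) (trans (sym (ℕP.+-suc (toℕ x) d)) x+d≡z)
    fixed′ : ∀ w → up m x < w → w ≤ z → ρ w ≡ w
    fixed′ w x′<w = fixed w (ℕP.<-trans x<x′ x′<w)

  walk : ∀ x z → x ≤ z → (∀ w → x < w → w ≤ z → ρ w ≡ w) → x ⇝ z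
  walk x z x≤z = walk-by (toℕ z ∸ toℕ x) x z (ℕP.m+[n∸m]≡n x≤z)

  exit : ∀ x b → x < b → (∀ w → x < w → w < b → ρ w ≡ w) → x ⇝ ρ b
  exit x (suc k) x<b fixed = ⇝-trans (walk x (inject₁ k) x≤k fixed′) (1 , jump)
    where
    x≤k : x ≤ inject₁ k
    x≤k = subst (toℕ x ℕ.≤_) (sym (FP.toℕ-inject₁ k)) (ℕ.s≤s⁻¹ x<b)
    fixed′ : ∀ w → x < w → w ≤ inject₁ k → ρ w ≡ w
    fixed′ w x<w w≤k = fixed w x<w (s≤s (subst (toℕ w ℕ.≤_) (FP.toℕ-inject₁ k) w≤k))
    jump : Z ⟨$⟩ʳ inject₁ k ≡ ρ (suc k)
    jump = trans (Z≗ _) (cong ρ (up-inject₁ m k))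

-- A 3-cycle p ↦ q ↦ r ↦ p with p < q < r, applied after the long cycle, gives a single
-- cycle: the orbit runs 0 ⋯ p−1, q ⋯ r−1, p ⋯ q−1, r ⋯ m.
module ThreeCycleAfterLong {m : ℕ} {p q r : Fin (suc m)} (p<q : p < q) (q<r : q < r)
                           {ρ : Fin (suc m) → Fin (suc m)} (ρ-3cycle : Is3Cycle ρ p q r)
                           (Z : Permutation′ (suc m)) (Z≗ : ∀ y → Z ⟨$⟩ʳ y ≡ ρ (up m y)) where
  open Orbits Z
  open ShiftThen ρ Z Z≗
  open Is3Cycle ρ-3cycle

  last : Fin (suc m)
  last = fromℕ m

  from-r : ∀ x → r ≤ x → x ⇝ last
  from-r x r≤x = walk x last (FP.≤fromℕ x) λ w x<w _ →
    let r<w = ℕP.≤-<-trans r≤x x<w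
    in elsewhere w (>⇒≢ (ℕP.<-trans p<q (ℕP.<-trans q<r r<w))) (>⇒≢ (ℕP.<-trans q<r r<w)) (>⇒≢ r<w)

  from-p : ∀ x → p ≤ x → x < q → x ⇝ last
  from-p x p≤x x<q = ⇝-trans (subst (x ⇝_) at-q (exit x q x<q λ w x<w w<q →
      elsewhere w (>⇒≢ (ℕP.≤-<-trans p≤x x<w)) (FP.<⇒≢ w<q) (FP.<⇒≢ (ℕP.<-trans w<q q<r))))
    (from-r r FP.≤-refl)

  from-q : ∀ x → q ≤ x → x < r → x ⇝ last
  from-q x q≤x x<r = ⇝-trans (subst (x ⇝_) at-r (exit x r x<r λ w x<w w<r →
      let q<w = ℕP.≤-<-trans q≤x x<w
      in elsewhere w (>⇒≢ (ℕP.<-trans p<q q<w)) (>⇒≢ q<w) (FP.<⇒≢ w<r)))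
    (from-p p FP.≤-refl p<q)

  from-0 : ∀ x → x < p → x ⇝ last
  from-0 x x<p = ⇝-trans (subst (x ⇝_) at-p (exit x p x<p λ w _ w<p →
      elsewhere w (FP.<⇒≢ w<p) (FP.<⇒≢ (ℕP.<-trans w<p p<q)) (FP.<⇒≢ (ℕP.<-trans w<p (ℕP.<-trans p<q q<r)))))
    (from-q q FP.≤-refl q<r)

  reach-last : ∀ x → x ⇝ last
  reach-last x with x <? p | x <? q | x <? r
  ... | yes x<p | _       | _       = from-0 x x<p
  ... | no x≮p  | yes x<q | _       = from-p x (ℕP.≮⇒≥ x≮p) x<q
  ... | no _    | no x≮q  | yes x<r = from-q x (ℕP.≮⇒≥ x≮q) x<r
  ... | no _    | no _    | no x≮r  = from-r x (ℕP.≮⇒≥ x≮r)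

  no-more-cycles : cycles Z ℕ.≤ cycles (longCycle (suc m))
  no-more-cycles = ℕP.≤-trans (one-orbit last reach-last) (cycles-positive (longCycle (suc m)))

afterLong : ∀ {n} → Transposition n → Transposition n → Permutation′ n
afterLong {n} t u = (longCycle n ∘ₚ toPerm t) ∘ₚ toPerm u

repeated-letter : ∀ {m} (a b : Fin (suc m)) (Z : Permutation′ (suc m)) →
                  (∀ y → Z ⟨$⟩ʳ y ≡ swap a b (swap a b (up m y))) → cycles Z ℕ.≤ cycles (longCycle (suc m))
repeated-letter {m} a b Z Z≗ =
  ℕP.≤-reflexive (cycles-≗ Z (longCycle (suc m)) (λ y → trans (Z≗ y) (swap-involutive a b (up m y))))

shared-first : ∀ {m} (t u : Transposition (suc m)) → fst t ≡ fst u → ¬ (snd u < snd t) →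
               cycles (afterLong t u) ℕ.≤ cycles (longCycle (suc m))
shared-first (i , a , i<a) (_ , b , _) refl b≮a with a ≟ b
... | yes refl = repeated-letter i a _ (λ _ → refl)
... | no a≢b   = ThreeCycleAfterLong.no-more-cycles i<a a<b (shared-first-3cycle i<a a<b) _ (λ _ → refl)
  where a<b = FP.≤∧≢⇒< (ℕP.≮⇒≥ b≮a) a≢b

shared-second : ∀ {m} (t u : Transposition (suc m)) → snd t ≡ snd u → ¬ (fst u < fst t) →
                cycles (afterLong t u) ℕ.≤ cycles (longCycle (suc m))
shared-second (a , j , _) (b , _ , b<j) refl b≮a with a ≟ b
... | yes refl = repeated-letter a j _ (λ _ → refl)
... | no a≢b   = ThreeCycleAfterLong.no-more-cycles a<b b<j (shared-second-3cycle a<b b<j) _ (λ _ → refl)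
  where a<b = FP.≤∧≢⇒< (ℕP.≮⇒≥ b≮a) a≢b

lemma3p2 : ∀ n k (γ : Fin k → Transposition n) → InΣ n k γ →
    ∀ (l m : Fin k) → l < m →
      (fst (γ l) ≡ fst (γ m) → snd (γ m) < snd (γ l)) ×
      (snd (γ l) ≡ snd (γ m) → fst (γ m) < fst (γ l))
lemma3p2 zero    k γ _   l m _   = ⊥-elim (FP.¬Fin0 (fst (γ l)))
lemma3p2 (suc n) k γ γ∈Σ l m l<m = first-shared , second-shared
  where
  impossible : cycles (afterLong (γ l) (γ m)) ℕ.≤ cycles (longCycle (suc n)) → ⊥
  impossible = no-cycle-preserving-pair (suc n) k γ γ∈Σ l m l<m _ (λ _ → refl)

  first-shared : fst (γ l) ≡ fst (γ m) → snd (γ m) < snd (γ l)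
  first-shared same = decidable-stable (snd (γ m) <? snd (γ l)) (impossible ∘ shared-first (γ l) (γ m) same)

  second-shared : snd (γ l) ≡ snd (γ m) → fst (γ m) < fst (γ l)
  second-shared same = decidable-stable (fst (γ m) <? fst (γ l)) (impossible ∘ shared-second (γ l) (γ m) same)
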